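{- For every positive integer $n$, the lattice $NS_n$ of non-straddling partitions of $[n]$ is left modular, i.e. it has a maximal chain each of whose elements is left modular.
   Context: $\Pi_n$ is the set of set partitions of $[n]$ ordered by refinement. A partition of $[n]$ is non-straddling if whenever a block $B$ contains $a$ and $d$ and a block $B'$ contains $b$ and $c$ with $a<b<c<d$, then $B=B'$. $NS_n$ is the subposet of $\Pi_n$ of non-straddling partitions; it is a finite lattice. An element $x$ of a lattice $L$ is left modular if $(x\vee y)\wedge z=(x\wedge z)\vee y$ for all $y\le z$ in $L$. A maximal chain is a chain maximal under inclusion. -}

module Defs where

open import Data.Nat using (ℕ)
open import Data.Fin using (Fin; _<_)
open import Data.Bool using (Bool; T)
open import Data.Product using (_×_)
open import Data.Sum using (_⊎_)
open import Data.List using (List)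
open import Data.List.Membership.Propositional using (_∈_)
open import Data.List.Relation.Unary.Any using (Any)
open import Relation.Binary.PropositionalEquality using (_≡_)

-- A set partition of [n] = Fin n, given by its (decidable) equivalence
-- relation "i and j lie in the same block".
record Partition (n : ℕ) : Set where
  field
    same      : Fin n → Fin n → Bool
    same-refl : ∀ i → T (same i i)
    same-sym  : ∀ i j → T (same i j) → T (same j i)
    same-trans : ∀ i j k → T (same i j) → T (same j k) → T (same i k)
open Partition public

NonStraddling : ∀ {n} → Partition n → Set
NonStraddling {n} p = ∀ (a b c d : Fin n) → a < b → b < c → c < d →
  T (same p a d) → T (same p b c) → T (same p a b)

record NS (n : ℕ) : Set where
  constructor ns
  field
    part : Partition n
    nonStraddling : NonStraddling part
open NS public

_≤ₚ_ : ∀ {n} → NS n → NS n → Set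
x ≤ₚ y = ∀ i j → T (same (part x) i j) → T (same (part y) i j)

_≈ₚ_ : ∀ {n} → NS n → NS n → Set
x ≈ₚ y = (x ≤ₚ y) × (y ≤ₚ x)

IsJoin : ∀ {n} → NS n → NS n → NS n → Set
IsJoin {n} x y j = (x ≤ₚ j) × (y ≤ₚ j) × (∀ (u : NS n) → x ≤ₚ u → y ≤ₚ u → j ≤ₚ u)

IsMeet : ∀ {n} → NS n → NS n → NS n → Set
IsMeet {n} x y m = (m ≤ₚ x) × (m ≤ₚ y) × (∀ (u : NS n) → u ≤ₚ x → u ≤ₚ y → u ≤ₚ m)

-- x is left modular in NS_n:  (x ∨ y) ∧ z = (x ∧ z) ∨ y  for all y ≤ z,
-- stated for the (unique up to ≈ₚ) joins/meets of the lattice NS_n.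
LeftModular : ∀ {n} → NS n → Set
LeftModular {n} x = ∀ (y z : NS n) → y ≤ₚ z →
  ∀ (xy lhs xz rhs : NS n) →
  IsJoin x y xy → IsMeet xy z lhs → IsMeet x z xz → IsJoin xz y rhs →
  lhs ≈ₚ rhs

IsChain : ∀ {n} → List (NS n) → Set
IsChain C = ∀ {x y} → x ∈ C → y ∈ C → (x ≤ₚ y) ⊎ (y ≤ₚ x)

IsMaximalChain : ∀ {n} → List (NS n) → Set
IsMaximalChain {n} C = IsChain C ×
  (∀ (p : NS n) → (∀ {x} → x ∈ C → (p ≤ₚ x) ⊎ (x ≤ₚ p)) → Any (p ≈ₚ_) C)

{-# OPTIONS --safe #-}
-- The chain is prefix 0 ≤ prefix 1 ≤ … ≤ prefix n, where prefix k has {0, …, k-1} as its only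
-- non-singleton block. A partition p comparable with all of them lies between prefix k and
-- prefix (k + 1) for the largest k with prefix k ≤ p, and is then equal to prefix k.
--
-- For x = prefix k only (x ∨ y) ∧ z ≤ r := (x ∧ z) ∨ y needs proof, and it suffices to find a
-- non-straddling u above x and r with u ∧ z ≤ r. As r and z agree on {0, …, k-1}, let u merge the
-- r-blocks meeting {0, …, k-1} together with the non-singleton r-blocks whose least element is
-- below t, raising t from k until the next such block would put two r-blocks into one z-block.
-- A straddle of u consists of two merged points b < c inside an unmerged r-block {a, …, d}; applying
-- non-straddling of z around the block that stopped the merging puts b and c in one z-block, hence
-- in one r-block.
module Submission where

open import Defs
open import Data.Nat using (ℕ; _≤_)
open import Data.Product using (Σ; _×_)
open import Data.List using (List)
open import Data.List.Relation.Unary.All using (All)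

open import Level using (0ℓ)
open import Function using (_∘_)
open import Data.Bool using (T)
open import Data.Empty using (⊥-elim)
open import Data.Nat as ℕ using (suc; s≤s⁻¹)
open import Data.Nat.Properties
  using ( ≤-refl; ≤-reflexive; ≤-trans; ≤-antisym; ≤-total; <-trans; <-≤-trans; ≤-<-trans; <⇒≤; <⇒≱
        ; ≮⇒≥; ≤∧≢⇒<; m≤m+n; m≤n+m; m<1+n⇒m<n∨m≡n; ≤⇒≤‴; ≤‴⇒≤)
open import Data.Fin using (Fin; toℕ; _<_)
open import Data.Fin.Properties
  using (any?; all?; toℕ-injective; toℕ<n; <⇒≢) renaming (_≟_ to _≟ᶠ_; <-cmp to <ᶠ-cmp)
open import Data.Product using (_,_; ∃-syntax)
open import Data.Sum using (_⊎_; inj₁; inj₂)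
import Data.Sum as Sum
import Data.Product as Product
open import Data.List using (map; upTo)
open import Data.List.Membership.Propositional using (_∈_)
open import Data.List.Membership.Propositional.Properties using (∈-map⁺; ∈-map⁻; ∈-upTo⁺)
open import Data.List.Relation.Unary.Any using (Any)
import Data.List.Relation.Unary.Any as Any
import Data.List.Relation.Unary.All as All
open import Relation.Binary.Core using (Rel)
open import Relation.Binary.Definitions using (tri<; tri≈; tri>)
open import Relation.Binary.Structures using (IsDecEquivalence)
open import Relation.Binary.PropositionalEquality using (_≡_; _≢_; refl; sym; trans; subst)
open import Relation.Binary.PropositionalEquality.Properties using (isDecEquivalence)
open import Relation.Nullary using (¬_; Dec; yes; no)
open import Relation.Nullary.Decidable
  using (⌊_⌋; toWitness; fromWitness; decidable-stable; _×-dec_; _⊎-dec_; _→-dec_; ¬?; T?)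
open import Relation.Unary using (Pred; Decidable)

private variable
  n : ℕ

infix 4 _∼[_]_
_∼[_]_ : Fin n → NS n → Fin n → Set
i ∼[ p ] j = T (same (part p) i j)

module _ (p : NS n) where

  ∼-refl : ∀ i → i ∼[ p ] i
  ∼-refl = same-refl (part p)

  ∼-sym : ∀ {i j} → i ∼[ p ] j → j ∼[ p ] i
  ∼-sym = same-sym (part p) _ _

  ∼-trans : ∀ {i j l} → i ∼[ p ] j → j ∼[ p ] l → i ∼[ p ] l
  ∼-trans = same-trans (part p) _ _ _

  ∼-nonStraddling : ∀ {a b c d} → a < b → b < c → c < d → a ∼[ p ] d → b ∼[ p ] c → a ∼[ p ] b
  ∼-nonStraddling = nonStraddling p _ _ _ _

  ∼-dec : ∀ i j → Dec (i ∼[ p ] j)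
  ∼-dec i j = T? (same (part p) i j)

  ∼-absorb : ∀ {e l q x j} → e ∼[ p ] l → e ∼[ p ] q → e < l → l < x → x < q →
             j ∼[ p ] x → j < x → e ∼[ p ] x
  ∼-absorb {e} {j = j} e∼l e∼q e<l l<x x<q j∼x j<x with <ᶠ-cmp e j
  ... | tri< e<j _ _ = ∼-trans (∼-nonStraddling e<j j<x x<q e∼q j∼x) j∼x
  ... | tri≈ _ refl _ = j∼x
  ... | tri> _ _ j<e = ∼-trans (∼-sym (∼-nonStraddling j<e e<l l<x j∼x e∼l)) j∼x

≤ₚ-trans : {x y u : NS n} → x ≤ₚ y → y ≤ₚ u → x ≤ₚ u
≤ₚ-trans x≤y y≤u i j = y≤u i j ∘ x≤y i j

≤ₚ? : (x y : NS n) → Dec (x ≤ₚ y)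
≤ₚ? x y = all? λ i → all? λ j → ∼-dec x i j →-dec ∼-dec y i j

module FromRel {_≈_ : Rel (Fin n) 0ℓ} (isDecEq : IsDecEquivalence _≈_)
  (nonStraddling≈ : ∀ {a b c d} → a < b → b < c → c < d → a ≈ d → b ≈ c → a ≈ b) where

  open IsDecEquivalence isDecEq renaming (refl to ≈-refl; sym to ≈-sym; trans to ≈-trans)

  partition : NS n
  partition = ns
    (record
      { same       = λ i j → ⌊ i ≟ j ⌋
      ; same-refl  = λ _ → fromWitness ≈-refl
      ; same-sym   = λ _ _ → fromWitness ∘ ≈-sym ∘ toWitness
      ; same-trans = λ _ _ _ i≈j j≈l → fromWitness (≈-trans (toWitness i≈j) (toWitness j≈l))
      })
    (λ _ _ _ _ a<b b<c c<d a≈d b≈c →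
      fromWitness (nonStraddling≈ a<b b<c c<d (toWitness a≈d) (toWitness b≈c)))

  ∼⁺ : ∀ {i j} → i ≈ j → i ∼[ partition ] j
  ∼⁺ = fromWitness

  ∼⁻ : ∀ {i j} → i ∼[ partition ] j → i ≈ j
  ∼⁻ = toWitness

module Discrete {n : ℕ} = FromRel (isDecEquivalence (_≟ᶠ_ {n}))
  (λ a<b b<c c<d a≡d _ → ⊥-elim (<⇒≢ (<-trans a<b (<-trans b<c c<d)) a≡d))

⊥ₚ : NS n
⊥ₚ = Discrete.partition

⊥ₚ-least : (p : NS n) → ⊥ₚ ≤ₚ p
⊥ₚ-least p i j i∼j with Discrete.∼⁻ i∼j
... | refl = ∼-refl p i

-- Merge the r-blocks in S into one block; inner and outer exclude the straddles this could create.
module Collapse (r : NS n) {S : Pred (Fin n) 0ℓ} (S? : Decidable S)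
  (S-resp : ∀ {i j} → i ∼[ r ] j → S i → S j)
  (inner : ∀ {b c d} → b < c → c < d → b ∼[ r ] c → S d → S b)
  (outer : ∀ {a b c d} → a < b → b < c → c < d → a ∼[ r ] d → S b → S c → S a ⊎ b ∼[ r ] c) where

  _≈_ : Rel (Fin n) 0ℓ
  i ≈ j = i ∼[ r ] j ⊎ (S i × S j)

  ≈-isDecEquivalence : IsDecEquivalence _≈_
  ≈-isDecEquivalence = record
    { isEquivalence = record { refl = inj₁ (∼-refl r _) ; sym = ≈-sym ; trans = ≈-trans }
    ; _≟_ = λ i j → ∼-dec r i j ⊎-dec (S? i ×-dec S? j)
    }
    where
    ≈-sym : ∀ {i j} → i ≈ j → j ≈ i
    ≈-sym (inj₁ i∼j) = inj₁ (∼-sym r i∼j)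
    ≈-sym (inj₂ (Si , Sj)) = inj₂ (Sj , Si)

    ≈-trans : ∀ {i j l} → i ≈ j → j ≈ l → i ≈ l
    ≈-trans (inj₁ i∼j) (inj₁ j∼l) = inj₁ (∼-trans r i∼j j∼l)
    ≈-trans (inj₁ i∼j) (inj₂ (Sj , Sl)) = inj₂ (S-resp (∼-sym r i∼j) Sj , Sl)
    ≈-trans (inj₂ (Si , Sj)) (inj₁ j∼l) = inj₂ (Si , S-resp j∼l Sj)
    ≈-trans (inj₂ (Si , _)) (inj₂ (_ , Sl)) = inj₂ (Si , Sl)

  ≈-nonStraddling : ∀ {a b c d} → a < b → b < c → c < d → a ≈ d → b ≈ c → a ≈ b
  ≈-nonStraddling a<b b<c c<d (inj₁ a∼d) (inj₁ b∼c) = inj₁ (∼-nonStraddling r a<b b<c c<d a∼d b∼c)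
  ≈-nonStraddling a<b b<c c<d (inj₂ (Sa , Sd)) (inj₁ b∼c) = inj₂ (Sa , inner b<c c<d b∼c Sd)
  ≈-nonStraddling a<b b<c c<d (inj₂ (Sa , _)) (inj₂ (Sb , _)) = inj₂ (Sa , Sb)
  ≈-nonStraddling a<b b<c c<d (inj₁ a∼d) (inj₂ (Sb , Sc)) with outer a<b b<c c<d a∼d Sb Sc
  ... | inj₁ Sa = inj₂ (Sa , Sb)
  ... | inj₂ b∼c = inj₁ (∼-nonStraddling r a<b b<c c<d a∼d b∼c)

  open FromRel ≈-isDecEquivalence ≈-nonStraddling public

  base≤ : r ≤ₚ partition
  base≤ _ _ = ∼⁺ ∘ inj₁

  block : ∀ {i j} → S i → S j → i ∼[ partition ] j
  block Si Sj = ∼⁺ (inj₂ (Si , Sj))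

  least : ∀ {u} → r ≤ₚ u → (∀ {i j} → S i → S j → i ∼[ u ] j) → partition ≤ₚ u
  least r≤u S≤u i j i∼j with ∼⁻ i∼j
  ... | inj₁ i∼ᵣj = r≤u i j i∼ᵣj
  ... | inj₂ (Si , Sj) = S≤u Si Sj

module SingleBlock {n : ℕ} {S : Pred (Fin n) 0ℓ} (S? : Decidable S) where

  private
    module C = Collapse ⊥ₚ S?
      (λ i∼j → subst S (Discrete.∼⁻ {n} i∼j))
      (λ b<c _ b∼c _ → ⊥-elim (<⇒≢ b<c (Discrete.∼⁻ {n} b∼c)))
      (λ a<b b<c c<d a∼d _ _ → ⊥-elim (<⇒≢ (<-trans a<b (<-trans b<c c<d)) (Discrete.∼⁻ {n} a∼d)))

  open C public using (partition; ∼⁻; block; base≤)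

  least : (u : NS n) → (∀ {i j} → S i → S j → i ∼[ u ] j) → partition ≤ₚ u
  least u = C.least {u} (⊥ₚ-least u)

module Prefix {n : ℕ} (k : ℕ) = SingleBlock {n} (λ i → toℕ i ℕ.<? k)

prefix : ℕ → NS n
prefix = Prefix.partition

leftModular-intro : (x : NS n) →
  (∀ r z → r ≤ₚ z → (∀ m → m ≤ₚ x → m ≤ₚ z → m ≤ₚ r) →
    ∃[ u ] (x ≤ₚ u × r ≤ₚ u × (∀ i j → i ∼[ u ] j → i ∼[ z ] j → i ∼[ r ] j))) →
  LeftModular x
leftModular-intro x separate y z y≤z xy lhs xz rhs
  (x≤xy , y≤xy , xy-least) (lhs≤xy , lhs≤z , lhs-greatest)
  (xz≤x , xz≤z , xz-greatest) (xz≤rhs , y≤rhs , rhs-least) = lhs≤rhs , rhs≤lhs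
  where
  rhs≤lhs : rhs ≤ₚ lhs
  rhs≤lhs = rhs-least lhs (lhs-greatest xz (≤ₚ-trans {x = xz} {x} {xy} xz≤x x≤xy) xz≤z)
                          (lhs-greatest y y≤xy y≤z)

  lhs≤rhs : lhs ≤ₚ rhs
  lhs≤rhs with separate rhs z (rhs-least z xz≤z y≤z)
                 (λ m m≤x m≤z → ≤ₚ-trans {x = m} {xz} {rhs} (xz-greatest m m≤x m≤z) xz≤rhs)
  ... | u , x≤u , rhs≤u , u∧z≤rhs = λ i j i∼j →
    let xy≤u = xy-least u x≤u (≤ₚ-trans {x = y} {rhs} {u} y≤rhs rhs≤u)
    in u∧z≤rhs i j (xy≤u i j (lhs≤xy i j i∼j)) (lhs≤z i j i∼j)

climb : {P : Pred ℕ 0ℓ} → Decidable P → ∀ {a b} → a ≤ b → P a →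
        ∃[ t ] (a ≤ t × t ≤ b × P t × (t ≡ b ⊎ (t ℕ.< b × ¬ P (suc t))))
climb {P} P? a≤b = go (≤⇒≤‴ a≤b)
  where
  go : ∀ {a b} → a ℕ.≤‴ b → P a → ∃[ t ] (a ≤ t × t ≤ b × P t × (t ≡ b ⊎ (t ℕ.< b × ¬ P (suc t))))
  go (ℕ.≤‴-reflexive a≡b) Pa = _ , ≤-refl , ≤-reflexive a≡b , Pa , inj₁ a≡b
  go {a} (ℕ.≤‴-step a<b) Pa with P? (suc a)
  ... | no ¬P1+a = a , ≤-refl , <⇒≤ (≤‴⇒≤ a<b) , Pa , inj₂ (≤‴⇒≤ a<b , ¬P1+a)
  ... | yes P1+a with go a<b P1+a
  ...   | t , a<t , t≤b , Pt , stop = t , <⇒≤ a<t , t≤b , Pt , stop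

module PrefixSeparation {n : ℕ} (k : ℕ) (r z : NS n) (r≤z : r ≤ₚ z)
  (agree : ∀ {i j} → toℕ i ℕ.< k → toℕ j ℕ.< k → i ∼[ z ] j → i ∼[ r ] j) where

  r⇒z : ∀ {i j} → i ∼[ r ] j → i ∼[ z ] j
  r⇒z = r≤z _ _

  NonSingleton : Pred (Fin n) 0ℓ
  NonSingleton i = ∃[ m ] (m ∼[ r ] i × m ≢ i)

  nonSingleton? : Decidable NonSingleton
  nonSingleton? i = any? λ m → ∼-dec r m i ×-dec ¬? (m ≟ᶠ i)

  nonSingleton-resp : ∀ {i j} → i ∼[ r ] j → NonSingleton i → NonSingleton j
  nonSingleton-resp {i} {j} i∼j (m , m∼i , m≢i) with m ≟ᶠ j
  ... | yes refl = i , i∼j , m≢i ∘ sym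
  ... | no m≢j = m , ∼-trans r m∼i i∼j , m≢j

  nonSingleton-intro : ∀ {b c} → b < c → b ∼[ r ] c → NonSingleton b
  nonSingleton-intro b<c b∼c = _ , ∼-sym r b∼c , <⇒≢ b<c ∘ sym

  another-member : ∀ {i s} → NonSingleton i → s ∼[ r ] i → ∃[ f ] (f ∼[ r ] s × f ≢ s)
  another-member {i} {s} (m , m∼i , m≢i) s∼i with s ≟ᶠ i
  ... | yes refl = m , m∼i , m≢i
  ... | no s≢i = i , ∼-sym r s∼i , s≢i ∘ sym

  Merged : ℕ → Pred (Fin n) 0ℓ
  Merged t i = ∃[ j ] (j ∼[ r ] i × (toℕ j ℕ.< k ⊎ (toℕ j ℕ.< t × NonSingleton i)))

  merged? : ∀ t → Decidable (Merged t)
  merged? t i = any? λ j →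
    ∼-dec r j i ×-dec ((toℕ j ℕ.<? k) ⊎-dec ((toℕ j ℕ.<? t) ×-dec nonSingleton? i))

  merged-resp : ∀ {t i j} → i ∼[ r ] j → Merged t i → Merged t j
  merged-resp i∼j (m , m∼i , inj₁ m<k) = m , ∼-trans r m∼i i∼j , inj₁ m<k
  merged-resp i∼j (m , m∼i , inj₂ (m<t , ns-i)) =
    m , ∼-trans r m∼i i∼j , inj₂ (m<t , nonSingleton-resp i∼j ns-i)

  merged-witness : ∀ {t i} → k ≤ t → Merged t i → ∃[ j ] (j ∼[ r ] i × toℕ j ℕ.< t)
  merged-witness k≤t (j , j∼i , inj₁ j<k) = j , j∼i , <-≤-trans j<k k≤t
  merged-witness k≤t (j , j∼i , inj₂ (j<t , _)) = j , j∼i , j<t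

  merged-inner : ∀ {t b c d} → b < c → c < d → b ∼[ r ] c → Merged t d → Merged t b
  merged-inner {b = b} b<c c<d b∼c (j , j∼d , small) with toℕ j ℕ.<? toℕ b
  ... | yes j<b =
    j , ∼-nonStraddling r j<b b<c c<d j∼d b∼c , Sum.map₂ (Product.map₂ λ _ → b-ns) small
    where
    b-ns : NonSingleton b
    b-ns = nonSingleton-intro b<c b∼c
  ... | no j≮b =
    b , ∼-refl r b , Sum.map (≤-<-trans b≤j) (Product.map (≤-<-trans b≤j) λ _ → b-ns) small
    where
    b≤j : toℕ b ≤ toℕ j
    b≤j = ≮⇒≥ j≮b

    b-ns : NonSingleton b
    b-ns = nonSingleton-intro b<c b∼c

  unmerged-bound : ∀ {t i m} → ¬ Merged t i → NonSingleton i → m ∼[ r ] i → t ≤ toℕ m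
  unmerged-bound ¬mi ns-i m∼i = ≮⇒≥ λ m<t → ¬mi (_ , m∼i , inj₂ (m<t , ns-i))

  newly-merged : ∀ {t i} → Merged (suc t) i → ¬ Merged t i →
                 ∃[ s ] (toℕ s ≡ t × s ∼[ r ] i × NonSingleton i)
  newly-merged (j , j∼i , inj₁ j<k) ¬mi = ⊥-elim (¬mi (j , j∼i , inj₁ j<k))
  newly-merged (j , j∼i , inj₂ (j<1+t , ns-i)) ¬mi =
    j , ≤-antisym (s≤s⁻¹ j<1+t) (unmerged-bound ¬mi ns-i j∼i) , j∼i , ns-i

  Leak : ℕ → Set
  Leak t = ∃[ i ] ∃[ j ] (Merged t i × Merged t j × i ∼[ z ] j × ¬ i ∼[ r ] j)

  leak? : ∀ t → Dec (Leak t)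
  leak? t = any? λ i → any? λ j →
    merged? t i ×-dec merged? t j ×-dec ∼-dec z i j ×-dec ¬? (∼-dec r i j)

  sealed : ∀ {t i j} → ¬ Leak t → Merged t i → Merged t j → i ∼[ z ] j → i ∼[ r ] j
  sealed {i = i} {j} ¬leak mi mj i∼j =
    decidable-stable (∼-dec r i j) λ i≁j → ¬leak (i , j , mi , mj , i∼j , i≁j)

  ¬leak-k : ¬ Leak k
  ¬leak-k (i , j , mi , mj , i∼j , i≁j) with merged-witness ≤-refl mi | merged-witness ≤-refl mj
  ... | a , a∼i , a<k | b , b∼j , b<k =
    i≁j (∼-trans r (∼-sym r a∼i) (∼-trans r (agree a<k b<k a∼b) b∼j))
    where
    a∼b : a ∼[ z ] b
    a∼b = ∼-trans z (r⇒z a∼i) (∼-trans z i∼j (∼-sym z (r⇒z b∼j)))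

  -- Why the merging stops at t: the next block, whose least element is t, is z-linked below t.
  record Entrance (t : ℕ) : Set where
    field
      s f e   : Fin n
      s≡t     : toℕ s ≡ t
      f∼s     : f ∼[ r ] s
      f≢s     : f ≢ s
      s-least : ∀ {m} → m ∼[ r ] s → t ≤ toℕ m
      e<t     : toℕ e ℕ.< t
      e∼s     : e ∼[ z ] s

  leak-linked-below : ∀ {t i j} → k ≤ t → Merged (suc t) i → ¬ Merged t i → Merged (suc t) j →
                      i ∼[ z ] j → ¬ i ∼[ r ] j → ∃[ e ] (toℕ e ℕ.< t × e ∼[ z ] i)
  leak-linked-below {t} {j = j} k≤t mi ¬mi mj i∼j i≁j with merged? t j
  ... | yes mj₀ with merged-witness k≤t mj₀
  ...   | e , e∼j , e<t = e , e<t , ∼-trans z (r⇒z e∼j) (∼-sym z i∼j)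
  leak-linked-below k≤t mi ¬mi mj i∼j i≁j | no ¬mj with newly-merged mi ¬mi | newly-merged mj ¬mj
  ... | s , s≡t , s∼i , _ | s′ , s′≡t , s′∼j , _ with toℕ-injective (trans s≡t (sym s′≡t))
  ...   | refl = ⊥-elim (i≁j (∼-trans r (∼-sym r s∼i) s′∼j))

  entrance-at : ∀ {t i j} → k ≤ t → Merged (suc t) i → ¬ Merged t i → Merged (suc t) j →
                i ∼[ z ] j → ¬ i ∼[ r ] j → Entrance t
  entrance-at k≤t mi ¬mi mj i∼j i≁j
    with newly-merged mi ¬mi | leak-linked-below k≤t mi ¬mi mj i∼j i≁j
  ... | s , s≡t , s∼i , ns-i | e , e<t , e∼i with another-member ns-i s∼i
  ...   | f , f∼s , f≢s = record
    { s = s ; f = f ; e = e ; s≡t = s≡t ; f∼s = f∼s ; f≢s = f≢s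
    ; s-least = λ m∼s → unmerged-bound ¬mi ns-i (∼-trans r m∼s s∼i)
    ; e<t = e<t ; e∼s = ∼-trans z e∼i (r⇒z (∼-sym r s∼i))
    }

  entrance : ∀ {t} → k ≤ t → ¬ Leak t → Leak (suc t) → Entrance t
  entrance {t} k≤t ¬leak (i , j , mi , mj , i∼j , i≁j) with merged? t i | merged? t j
  ... | no ¬mi | _ = entrance-at k≤t mi ¬mi mj i∼j i≁j
  ... | yes _ | no ¬mj = entrance-at k≤t mj ¬mj mi (∼-sym z i∼j) (i≁j ∘ ∼-sym r)
  ... | yes mi₀ | yes mj₀ = ⊥-elim (¬leak (i , j , mi₀ , mj₀ , i∼j , i≁j))

  module _ {t : ℕ} (E : Entrance t) where
    open Entrance E

    <t⇒<s : ∀ {m : Fin n} → toℕ m ℕ.< t → m < s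
    <t⇒<s {m} = subst (toℕ m ℕ.<_) (sym s≡t)

    s<f : s < f
    s<f = ≤∧≢⇒< (subst (ℕ._≤ toℕ f) (sym s≡t) (s-least f∼s)) (f≢s ∘ sym ∘ toℕ-injective)

    -- By minimality of s, nothing linked to an element below t can sit beyond f.
    entrance-right : ∀ {j x} → j ∼[ r ] x → toℕ j ℕ.< t → s < x → x < f
    entrance-right {j} {x} j∼x j<t s<x with <ᶠ-cmp x f
    ... | tri< x<f _ _ = x<f
    ... | tri≈ _ refl _ = ⊥-elim (<⇒≱ j<t (s-least (∼-trans r j∼x f∼s)))
    ... | tri> _ _ f<x =
      ⊥-elim (<⇒≱ j<t (s-least (∼-nonStraddling r (<t⇒<s {j} j<t) s<f f<x j∼x (∼-sym r f∼s))))

    entrance-bracket : ∀ {a b c d j : Fin n} → t ≤ toℕ a → a < b → b < c → c < d → a ∼[ r ] d →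
      j ∼[ r ] c → toℕ j ℕ.< t → ∃[ l ] ∃[ q ] (e ∼[ z ] l × e ∼[ z ] q × e < l × l < b × c < q)
    entrance-bracket {a} {b} {c} {d} t≤a a<b b<c c<d a∼d j∼c j<t with ∼-dec r s a
    ... | yes s∼a = a , d , e∼a , ∼-trans z e∼a (r⇒z a∼d) , <-≤-trans e<t t≤a , a<b , c<d
      where
      e∼a : e ∼[ z ] a
      e∼a = ∼-trans z e∼s (r⇒z s∼a)
    ... | no s≁a = s , f , e∼s , ∼-trans z e∼s (r⇒z (∼-sym r f∼s)) , <t⇒<s {e} e<t , s<b ,
                   entrance-right j∼c j<t (<-trans s<b b<c)
      where
      s<a : s < a
      s<a = ≤∧≢⇒< (subst (ℕ._≤ toℕ a) (sym s≡t) t≤a)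
                  (λ s≡a → s≁a (subst (s ∼[ r ]_) (toℕ-injective s≡a) (∼-refl r s)))

      s<b : s < b
      s<b = <-trans s<a a<b

    straddled-linked : ∀ {a b c d : Fin n} → k ≤ t → t ≤ toℕ a → a < b → b < c → c < d →
                       a ∼[ r ] d → Merged t b → Merged t c → b ∼[ z ] c
    straddled-linked {a} {b} {c} {d} k≤t t≤a a<b b<c c<d a∼d mb mc =
      let (j , j∼b , j<t) = merged-witness k≤t mb
          (j′ , j′∼c , j′<t) = merged-witness k≤t mc
          (l , q , e∼l , e∼q , e<l , l<b , c<q) =
            entrance-bracket {a} {b} {c} {d} {j′} t≤a a<b b<c c<d a∼d j′∼c j′<t
          e∼b : e ∼[ z ] b
          e∼b = ∼-absorb z {j = j} e∼l e∼q e<l l<b (<-trans b<c c<q) (r⇒z j∼b)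
                         (<-trans (<-≤-trans j<t t≤a) a<b)
          e∼c : e ∼[ z ] c
          e∼c = ∼-absorb z {j = j′} e∼l e∼q e<l (<-trans l<b b<c) c<q (r⇒z j′∼c)
                         (<-trans (<-≤-trans j′<t t≤a) (<-trans a<b b<c))
      in ∼-trans z (∼-sym z e∼b) e∼c

  merged-outer : ∀ {t} → k ≤ t → ¬ Leak t → n ≤ t ⊎ Entrance t →
    ∀ {a b c d} → a < b → b < c → c < d → a ∼[ r ] d → Merged t b → Merged t c →
    Merged t a ⊎ b ∼[ r ] c
  merged-outer {t} k≤t ¬leak stop {a} {b} {c} {d} a<b b<c c<d a∼d mb mc with merged? t a
  ... | yes ma = inj₁ ma
  ... | no ¬ma = inj₂ (sealed ¬leak mb mc (linked stop))
    where
    t≤a : t ≤ toℕ a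
    t≤a = unmerged-bound ¬ma (nonSingleton-intro (<-trans a<b (<-trans b<c c<d)) a∼d) (∼-refl r a)

    linked : n ≤ t ⊎ Entrance t → b ∼[ z ] c
    linked (inj₁ n≤t) = ⊥-elim (<⇒≱ (toℕ<n a) (≤-trans n≤t t≤a))
    linked (inj₂ E) = straddled-linked E k≤t t≤a a<b b<c c<d a∼d mb mc

  module Upper {t} (k≤t : k ≤ t) (¬leak : ¬ Leak t) (stop : n ≤ t ⊎ Entrance t) =
    Collapse r (merged? t) (merged-resp {t}) (merged-inner {t}) (merged-outer k≤t ¬leak stop)

  separation : ∃[ u ] (prefix k ≤ₚ u × r ≤ₚ u × (∀ i j → i ∼[ u ] j → i ∼[ z ] j → i ∼[ r ] j))
  separation with climb (¬? ∘ leak?) (m≤n+m k n) ¬leak-k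
  ... | t , k≤t , _ , ¬leak , stop =
    U.partition , prefix≤U , U.base≤ , U∧z≤r
    where
    stop′ : n ≤ t ⊎ Entrance t
    stop′ = Sum.map (λ t≡n+k → subst (n ≤_) (sym t≡n+k) (m≤m+n n k))
                    (entrance k≤t ¬leak ∘ decidable-stable (leak? (suc t)) ∘ Product.proj₂) stop

    module U = Upper k≤t ¬leak stop′

    prefix≤U : prefix k ≤ₚ U.partition
    prefix≤U = Prefix.least k U.partition
                 λ {i} {j} i<k j<k → U.block (i , ∼-refl r i , inj₁ i<k) (j , ∼-refl r j , inj₁ j<k)

    U∧z≤r : ∀ i j → i ∼[ U.partition ] j → i ∼[ z ] j → i ∼[ r ] j
    U∧z≤r i j i∼j i∼zj with U.∼⁻ i∼j
    ... | inj₁ i∼rj = i∼rj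
    ... | inj₂ (mi , mj) = sealed ¬leak mi mj i∼zj

module Pair {n : ℕ} (i j : Fin n) = SingleBlock (λ a → (a ≟ᶠ i) ⊎-dec (a ≟ᶠ j))

pair-least : ∀ {i j} (p : NS n) → i ∼[ p ] j → Pair.partition i j ≤ₚ p
pair-least {i = i} {j} p i∼j = Pair.least i j p λ where
  (inj₁ refl) (inj₁ refl) → ∼-refl p i
  (inj₁ refl) (inj₂ refl) → i∼j
  (inj₂ refl) (inj₁ refl) → ∼-sym p i∼j
  (inj₂ refl) (inj₂ refl) → ∼-refl p j

prefix-leftModular : ∀ k → LeftModular (prefix {n} k)
prefix-leftModular k = leftModular-intro (prefix k) λ r z r≤z below →
  PrefixSeparation.separation k r z r≤z λ {i} {j} i<k j<k i∼j →
    below (Pair.partition i j) (pair-least (prefix k) (Prefix.block k i<k j<k)) (pair-least z i∼j)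
          i j (Pair.block i j (inj₁ refl) (inj₂ refl))

prefix-mono : ∀ {k l} → k ≤ l → prefix {n} k ≤ₚ prefix l
prefix-mono {k = k} {l} k≤l =
  Prefix.least k (prefix l) λ i<k j<k → Prefix.block l (<-≤-trans i<k k≤l) (<-≤-trans j<k k≤l)

prefix-top : ∀ {k} (p : NS n) → n ≤ k → p ≤ₚ prefix k
prefix-top {k = k} p n≤k i j _ = Prefix.block k (<-≤-trans (toℕ<n i) n≤k) (<-≤-trans (toℕ<n j) n≤k)

prefix-extend : ∀ {k i j} (p : NS n) → prefix k ≤ₚ p → toℕ i ≡ k → toℕ j ℕ.< k → i ∼[ p ] j →
                prefix (suc k) ≤ₚ p
prefix-extend {k = k} {i} {j} p k≤p i≡k j<k i∼j =
  Prefix.least (suc k) p λ a<1+k b<1+k → ∼-trans p (to-j a<1+k) (∼-sym p (to-j b<1+k))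
  where
  to-j : ∀ {a} → toℕ a ℕ.< suc k → a ∼[ p ] j
  to-j {a} a<1+k with m<1+n⇒m<n∨m≡n a<1+k
  ... | inj₁ a<k = k≤p a j (Prefix.block k a<k j<k)
  ... | inj₂ a≡k with toℕ-injective (trans a≡k (sym i≡k))
  ...   | refl = i∼j

prefix-below : ∀ {k} (p : NS n) → prefix k ≤ₚ p → p ≤ₚ prefix (suc k) → ¬ prefix (suc k) ≤ₚ p →
               p ≤ₚ prefix k
prefix-below {k = k} p k≤p p≤1+k 1+k≰p i j i∼j with Prefix.∼⁻ (suc k) (p≤1+k i j i∼j)
... | inj₁ i≡j = Prefix.base≤ k i j i≡j
... | inj₂ (i<1+k , j<1+k) with m<1+n⇒m<n∨m≡n i<1+k | m<1+n⇒m<n∨m≡n j<1+k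
...   | inj₁ i<k | inj₁ j<k = Prefix.block k i<k j<k
...   | inj₂ i≡k | inj₁ j<k = ⊥-elim (1+k≰p (prefix-extend p k≤p i≡k j<k i∼j))
...   | inj₁ i<k | inj₂ j≡k = ⊥-elim (1+k≰p (prefix-extend p k≤p j≡k i<k (∼-sym p i∼j)))
...   | inj₂ i≡k | inj₂ j≡k with toℕ-injective (trans i≡k (sym j≡k))
...     | refl = ∼-refl (prefix k) i

chain : (n : ℕ) → List (NS n)
chain n = map prefix (upTo (suc n))

∈-chain⁺ : ∀ {k} → k ≤ n → prefix k ∈ chain n
∈-chain⁺ k≤n = ∈-map⁺ prefix (∈-upTo⁺ (ℕ.s≤s k≤n))

∈-chain⁻ : ∀ {x} → x ∈ chain n → ∃[ k ] x ≡ prefix k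
∈-chain⁻ x∈chain with ∈-map⁻ prefix x∈chain
... | k , _ , x≡prefix-k = k , x≡prefix-k

chain-isChain : IsChain (chain n)
chain-isChain x∈chain y∈chain with ∈-chain⁻ x∈chain | ∈-chain⁻ y∈chain
... | k , refl | l , refl with ≤-total k l
...   | inj₁ k≤l = inj₁ (prefix-mono k≤l)
...   | inj₂ l≤k = inj₂ (prefix-mono l≤k)

chain-maximal : (p : NS n) → (∀ {x} → x ∈ chain n → p ≤ₚ x ⊎ x ≤ₚ p) → Any (p ≈ₚ_) (chain n)
chain-maximal {n} p comparable with climb (λ k → ≤ₚ? (prefix k) p) ℕ.z≤n (Prefix.least 0 p λ ())
... | k , _ , k≤n , k≤p , stop = Any.map (λ { refl → p≤k stop , k≤p }) (∈-chain⁺ k≤n)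
  where
  p≤k : k ≡ n ⊎ (k ℕ.< n × ¬ prefix (suc k) ≤ₚ p) → p ≤ₚ prefix k
  p≤k (inj₁ refl) = prefix-top p ≤-refl
  p≤k (inj₂ (k<n , 1+k≰p)) with comparable (∈-chain⁺ k<n)
  ... | inj₁ p≤1+k = prefix-below p k≤p p≤1+k 1+k≰p
  ... | inj₂ 1+k≤p = ⊥-elim (1+k≰p 1+k≤p)

corollary2 : ∀ (n : ℕ) → 1 ≤ n →
    Σ (List (NS n)) (λ C → IsMaximalChain C × All LeftModular C)
corollary2 n _ = chain n , (chain-isChain , chain-maximal) , All.tabulate chain-leftModular
  where
  chain-leftModular : ∀ {x} → x ∈ chain n → LeftModular x
  chain-leftModular x∈chain with ∈-chain⁻ x∈chain
  ... | k , refl = prefix-leftModular k
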